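{- For any partial function $f\colon\{0,1\}^n\to\{0,1,\perp\}$ with $F(x,y)=f(x\oplus y)$, if $\mathrm{NADT^{\oplus}}(f)\ge n-1$, then $\mathrm{D_{cc}^{\rightarrow}}(F)=\mathrm{NADT^{\oplus}}(f)$.
   Context: $\operatorname{Dom}(f)=f^{ -1}(\{0,1\})$, $\oplus$ is bitwise XOR, $\operatorname{Dom}(F)=\{(x,y):x\oplus y\in\operatorname{Dom}(f)\}$. $\mathrm{D_{cc}^{\rightarrow}}(F)$ is the minimum $t$ such that there are total $h\colon\{0,1\}^n\to\{0,1\}^t$ and $\varphi\colon\{0,1\}^t\times\{0,1\}^n\to\{0,1\}$ with $\varphi(h(x),y)=F(x,y)$ for all $(x,y)\in\operatorname{Dom}(F)$. With $\langle s,x\rangle=\bigoplus_is_i\wedge x_i$, $\mathrm{NADT^{\oplus}}(f)$ is the minimum $p$ such that there are $s_1,\dots,s_p\in\{0,1\}^n$ and total $l\colon\{0,1\}^p\to\{0,1\}$ with $l(\langle s_1,x\rangle,\dots,\langle s_p,x\rangle)=f(x)$ for all $x\in\operatorname{Dom}(f)$. -}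

module Defs where

open import Data.Bool using (Bool; true; false; _∧_; _xor_)
open import Data.Maybe using (Maybe; just; nothing)
open import Data.Nat using (ℕ; _≤_)
open import Data.Vec using (Vec; zipWith; foldr; map)
open import Data.Product using (Σ; _×_)
open import Relation.Binary.PropositionalEquality using (_≡_)

-- {0,1}^n as Vec Bool n; a partial function f : {0,1}^n → {0,1,⊥}
-- is a total map into Maybe Bool, with nothing = ⊥.
Bits : ℕ → Set
Bits n = Vec Bool n

PartialFn : ℕ → Set
PartialFn n = Bits n → Maybe Bool

_⊕_ : ∀ {n} → Bits n → Bits n → Bits n
x ⊕ y = zipWith _xor_ x y

⟨_,_⟩ : ∀ {n} → Bits n → Bits n → Bool
⟨ s , x ⟩ = foldr (λ _ → Bool) _xor_ false (zipWith _∧_ s x)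

XorLift : ∀ {n} → PartialFn n → Bits n → Bits n → Maybe Bool
XorLift f x y = f (x ⊕ y)

OneWayProtocol : ∀ {n} → (Bits n → Bits n → Maybe Bool) → ℕ → Set
OneWayProtocol {n} F t =
  Σ (Bits n → Bits t) λ h →
  Σ (Bits t → Bits n → Bool) λ φ →
  ∀ x y b → F x y ≡ just b → φ (h x) y ≡ b

NADTComputes : ∀ {n} → PartialFn n → ℕ → Set
NADTComputes {n} f p =
  Σ (Vec (Bits n) p) λ ss →
  Σ (Bits p → Bool) λ l →
  ∀ x b → f x ≡ just b → l (map (λ s → ⟨ s , x ⟩) ss) ≡ b

IsMinimum : (ℕ → Set) → ℕ → Set
IsMinimum P t = P t × (∀ t′ → P t′ → t ≤ t′)

DccOneWayIs : ∀ {n} → (Bits n → Bits n → Maybe Bool) → ℕ → Set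
DccOneWayIs F t = IsMinimum (OneWayProtocol F) t

NADTIs : ∀ {n} → PartialFn n → ℕ → Set
NADTIs f p = IsMinimum (NADTComputes f) p

-- The upper bound is the obvious protocol: Alice sends the p parities ⟨ sᵢ , x ⟩ and
-- Bob recovers ⟨ sᵢ , x ⊕ y ⟩ = ⟨ sᵢ , x ⟩ xor ⟨ sᵢ , y ⟩ by linearity.
-- For the lower bound, if two inputs xa ≠ xb receive the same message, Bob answers
-- alike on (xa , y) and (xb , y), so f agrees on any two points whose difference is
-- xa ⊕ xb.  Hence f factors through the linear quotient map by ⟨ xa ⊕ xb ⟩, and a
-- linear map to {0,1}ᵐ is m parity queries: a protocol of cost t ≤ n − 1 gives
-- NADT(f) ≤ n − 1.  A protocol of cost t ≤ n − 2 even has three inputs with a common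
-- message, so f factors through a quotient by a plane and NADT(f) ≤ n − 2, which the
-- hypothesis excludes.  Costs t ≥ n are covered by the trivial tree querying every bit.
module Submission where

open import Defs
open import Algebra.Bundles using (AbelianGroup; CommutativeRing)
open import Algebra.Structures using (IsAbelianGroup)
import Algebra.Properties.AbelianGroup as AbelianGroupProperties
import Algebra.Properties.CommutativeSemigroup as CommutativeSemigroupProperties
import Algebra.Properties.Quasigroup as QuasigroupProperties
open import Data.Bool using (Bool; true; false; _∧_; _xor_)
open import Data.Bool.Properties
  using (xor-assoc; xor-comm; xor-identityˡ; xor-identityʳ; xor-same; xor-∧-commutativeRing;
         ∧-distribˡ-xor; ∧-identityʳ; ∧-zeroʳ)
  renaming (_≟_ to _≟ᵇ_)
open import Data.Fin using (Fin; funToFin; finToFun; combine)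
  renaming (zero to fzero; suc to fsuc; _<_ to _<ᶠ_)
open import Data.Fin.Properties
  using (2↔Bool; funToFin-finToFin; finToFun-funToFin; pigeonhole; any?; <-cmp; <-irrefl; <-trans; _<?_)
open import Data.Maybe using (Maybe; just; nothing)
open import Data.Maybe.Properties using (just-injective)
open import Data.Nat using (ℕ; zero; suc; _∸_; _≤_; _<_; _^_; s≤s; z≤n)
open import Data.Nat.Properties using (^-monoʳ-<; ≤-refl; ≤-trans; 1+n≰n)
import Data.Nat.Properties as ℕ
open import Data.Product using (∃; _×_; _,_; proj₁; proj₂)
open import Data.Sum using (_⊎_; inj₁; inj₂)
open import Data.Vec using (Vec; []; _∷_; replicate; lookup; tabulate; map; head; tail)
open import Data.Vec.Properties
  using (zipWith-assoc; zipWith-comm; zipWith-identityˡ; zipWith-identityʳ; lookup-zipWith;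
         tabulate-cong; tabulate-∘; tabulate∘lookup; lookup∘tabulate; ≡-dec)
open import Function using (_∘_; id)
open import Function.Bundles using (Inverse)
open import Level using (0ℓ)
open import Relation.Binary.Definitions using (tri<; tri≈; tri>)
open import Relation.Binary.PropositionalEquality
open import Relation.Binary.PropositionalEquality.Algebra using (isMagma)
open import Relation.Nullary using (Dec; yes; no; does; contradiction)
open import Relation.Nullary.Decidable using (_×-dec_; map′)

0s : ∀ {n} → Bits n
0s = replicate _ false

⊕-self : ∀ {n} (a : Bits n) → a ⊕ a ≡ 0s
⊕-self []       = refl
⊕-self (a ∷ as) = cong₂ _∷_ (xor-same a) (⊕-self as)

⊕-isAbelianGroup : ∀ n → IsAbelianGroup _≡_ (_⊕_ {n}) 0s id
⊕-isAbelianGroup n = record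
  { isGroup = record
    { isMonoid = record
      { isSemigroup = record { isMagma = isMagma _⊕_ ; assoc = zipWith-assoc xor-assoc }
      ; identity    = zipWith-identityˡ xor-identityˡ , zipWith-identityʳ xor-identityʳ
      }
    ; inverse = ⊕-self , ⊕-self
    ; ⁻¹-cong = cong id
    }
  ; comm = zipWith-comm xor-comm
  }

⊕-abelianGroup : ℕ → AbelianGroup 0ℓ 0ℓ
⊕-abelianGroup n = record { isAbelianGroup = ⊕-isAbelianGroup n }

module ⊕ {n : ℕ} where
  open AbelianGroup (⊕-abelianGroup n) public using (assoc; identityˡ; identityʳ)
  open AbelianGroup (⊕-abelianGroup n) using (commutativeSemigroup)
  open AbelianGroupProperties (⊕-abelianGroup n) public using (x∙y⁻¹≈ε⇒x≈y; \\-leftDividesʳ)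
  open AbelianGroupProperties (⊕-abelianGroup n) using (quasigroup)
  open QuasigroupProperties quasigroup public using (cancelˡ; x≈z//y)
  open CommutativeSemigroupProperties commutativeSemigroup public using (interchange)

module Xor = CommutativeSemigroupProperties (CommutativeRing.+-commutativeSemigroup xor-∧-commutativeRing)

⊕≡0s⇒≡ : ∀ {n} {a b : Bits n} → a ⊕ b ≡ 0s → a ≡ b
⊕≡0s⇒≡ = ⊕.x∙y⁻¹≈ε⇒x≈y _ _

⊕-difference : ∀ {n} (a b c : Bits n) → (a ⊕ b) ⊕ (a ⊕ c) ≡ b ⊕ c
⊕-difference a b c = begin
  (a ⊕ b) ⊕ (a ⊕ c)  ≡⟨ ⊕.interchange a b a c ⟩
  (a ⊕ a) ⊕ (b ⊕ c)  ≡⟨ cong (_⊕ (b ⊕ c)) (⊕-self a) ⟩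
  0s ⊕ (b ⊕ c)       ≡⟨ ⊕.identityˡ (b ⊕ c) ⟩
  b ⊕ c              ∎
  where open ≡-Reasoning

IsLinear : ∀ {n m} → (Bits n → Bits m) → Set
IsLinear Q = ∀ a b → Q (a ⊕ b) ≡ Q a ⊕ Q b

IsLinearForm : ∀ {n} → (Bits n → Bool) → Set
IsLinearForm g = ∀ a b → g (a ⊕ b) ≡ g a xor g b

∘-linear : ∀ {n m k} (Q : Bits n → Bits m) (R : Bits m → Bits k) →
           IsLinear Q → IsLinear R → IsLinear (R ∘ Q)
∘-linear Q R Q-lin R-lin a b = trans (cong R (Q-lin a b)) (R-lin (Q a) (Q b))

linear-fibre : ∀ {n m} (Q : Bits n → Bits m) → IsLinear Q →
               ∀ {u v} → Q u ≡ Q v → Q (u ⊕ v) ≡ 0s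
linear-fibre Q Q-lin {u} {v} Qu≡Qv =
  trans (Q-lin u v) (trans (cong (_⊕ Q v) Qu≡Qv) (⊕-self (Q v)))

linearForm-0s : ∀ {n} (g : Bits n → Bool) → IsLinearForm g → g 0s ≡ false
linearForm-0s g g-lin =
  trans (cong g (sym (⊕-self 0s))) (trans (g-lin 0s 0s) (xor-same (g 0s)))

⟨⟩-linear : ∀ {n} (s : Bits n) → IsLinearForm (⟨ s ,_⟩)
⟨⟩-linear []       []       []       = refl
⟨⟩-linear (s ∷ ss) (x ∷ xs) (y ∷ ys) =
  trans (cong₂ _xor_ (∧-distribˡ-xor s x y) (⟨⟩-linear ss xs ys))
        (Xor.interchange (s ∧ x) (s ∧ y) ⟨ ss , xs ⟩ ⟨ ss , ys ⟩)

parities : ∀ {n p} → Vec (Bits n) p → Bits n → Bits p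
parities ss x = map (⟨_, x ⟩) ss

parities-linear : ∀ {n p} (ss : Vec (Bits n) p) → IsLinear (parities ss)
parities-linear []       x y = refl
parities-linear (s ∷ ss) x y = cong₂ _∷_ (⟨⟩-linear s x y) (parities-linear ss x y)

linearForm⇒⟨⟩ : ∀ {n} (g : Bits n → Bool) → IsLinearForm g → ∃ λ s → ∀ x → ⟨ s , x ⟩ ≡ g x
linearForm⇒⟨⟩ {zero}  g g-lin = [] , λ { [] → sym (linearForm-0s g g-lin) }
linearForm⇒⟨⟩ {suc n} g g-lin
  with s , s-correct ← linearForm⇒⟨⟩ (g ∘ (false ∷_)) (λ a b → g-lin (false ∷ a) (false ∷ b))
  = g (true ∷ 0s) ∷ s , λ { (b ∷ x) → trans (cong₂ _xor_ (head-term b) (s-correct x)) (sym (split b x)) }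
  where
  head-term : ∀ b → g (true ∷ 0s) ∧ b ≡ g (b ∷ 0s)
  head-term true  = ∧-identityʳ _
  head-term false = trans (∧-zeroʳ _) (sym (linearForm-0s g g-lin))
  split : ∀ b x → g (b ∷ x) ≡ g (b ∷ 0s) xor g (false ∷ x)
  split b x = trans (cong g (cong₂ _∷_ (sym (xor-identityʳ b)) (sym (⊕.identityˡ x))))
                    (g-lin (b ∷ 0s) (false ∷ x))

linear⇒parities : ∀ {n m} (Q : Bits n → Bits m) → IsLinear Q →
                  ∃ λ (ss : Vec (Bits n) m) → ∀ x → parities ss x ≡ Q x
linear⇒parities {n} {m} Q Q-lin = tabulate (proj₁ ∘ row) , correct
  where
  row : ∀ i → ∃ λ s → ∀ x → ⟨ s , x ⟩ ≡ lookup (Q x) i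
  row i = linearForm⇒⟨⟩ (λ x → lookup (Q x) i)
            (λ a b → trans (cong (λ v → lookup v i) (Q-lin a b)) (lookup-zipWith _xor_ i (Q a) (Q b)))
  correct : ∀ x → parities (tabulate (proj₁ ∘ row)) x ≡ Q x
  correct x = begin
    map (⟨_, x ⟩) (tabulate (proj₁ ∘ row))  ≡⟨ tabulate-∘ _ _ ⟨
    tabulate (λ i → ⟨ proj₁ (row i) , x ⟩)  ≡⟨ tabulate-cong (λ i → proj₂ (row i) x) ⟩
    tabulate (lookup (Q x))                 ≡⟨ tabulate∘lookup (Q x) ⟩
    Q x                                     ∎
    where open ≡-Reasoning

_≟_ : ∀ {n} (x y : Bits n) → Dec (x ≡ y)
_≟_ = ≡-dec _≟ᵇ_

toFin : ∀ {n} → Bits n → Fin (2 ^ n)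
toFin x = funToFin (Inverse.from 2↔Bool ∘ lookup x)

fromFin : ∀ {n} → Fin (2 ^ n) → Bits n
fromFin k = tabulate (Inverse.to 2↔Bool ∘ finToFun k)

fromFin-toFin : ∀ {n} (x : Bits n) → fromFin (toFin x) ≡ x
fromFin-toFin x = trans
  (tabulate-cong λ i → trans (cong (Inverse.to 2↔Bool) (finToFun-funToFin _ i))
                             (Inverse.strictlyInverseˡ 2↔Bool (lookup x i)))
  (tabulate∘lookup x)

funToFin-cong : ∀ {m n} {g g′ : Fin m → Fin n} → (∀ i → g i ≡ g′ i) → funToFin g ≡ funToFin g′
funToFin-cong {zero}  g≗g′ = refl
funToFin-cong {suc m} g≗g′ = cong₂ combine (g≗g′ fzero) (funToFin-cong (g≗g′ ∘ fsuc))

toFin-fromFin : ∀ {n} (k : Fin (2 ^ n)) → toFin {n} (fromFin k) ≡ k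
toFin-fromFin {n} k = trans
  (funToFin-cong {n} {2} λ i →
     trans (cong (Inverse.from 2↔Bool) (lookup∘tabulate _ i))
           (Inverse.strictlyInverseʳ 2↔Bool (finToFun {2} {n} k i)))
  (funToFin-finToFin {n} {2} k)

toFin-injective : ∀ {n} {x y : Bits n} → toFin x ≡ toFin y → x ≡ y
toFin-injective {x = x} {y} eq = trans (sym (fromFin-toFin x)) (trans (cong fromFin eq) (fromFin-toFin y))

fromFin-injective : ∀ {n} {i j : Fin (2 ^ n)} → fromFin {n} i ≡ fromFin j → i ≡ j
fromFin-injective {n} {i} {j} eq =
  trans (sym (toFin-fromFin {n} i)) (trans (cong toFin eq) (toFin-fromFin {n} j))

∃Bits? : ∀ {n} {P : Bits n → Set} → (∀ x → Dec (P x)) → Dec (∃ P)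
∃Bits? {P = P} P? =
  map′ (λ (k , p) → fromFin k , p)
       (λ (x , p) → toFin x , subst P (sym (fromFin-toFin x)) p)
       (any? (P? ∘ fromFin))

record Collision {n t} (h : Bits n → Bits t) : Set where
  field
    x₁ x₂    : Bits n
    distinct : x₁ ≢ x₂
    collide  : h x₁ ≡ h x₂

record TripleCollision {n t} (h : Bits n → Bits t) : Set where
  field
    x₁ x₂ x₃    : Bits n
    distinct₁₂  : x₁ ≢ x₂
    distinct₁₃  : x₁ ≢ x₃
    distinct₂₃  : x₂ ≢ x₃
    collide₁₂   : h x₁ ≡ h x₂
    collide₁₃   : h x₁ ≡ h x₃

collision : ∀ {n t} → t < n → (h : Bits n → Bits t) → Collision h
collision {n} {t} t<n h
  with i , j , i<j , eq ← pigeonhole (^-monoʳ-< 2 (s≤s (s≤s z≤n)) t<n) (toFin ∘ h ∘ fromFin)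
  = record
  { x₁ = fromFin i ; x₂ = fromFin j
  ; distinct = λ eq′ → <-irrefl (fromFin-injective {n} eq′) i<j
  ; collide  = toFin-injective eq
  }

-- Tagging each input with whether an earlier input (in the order of toFin) has the
-- same message, a collision of the tagged map yields three inputs with one message.
module _ {n t} (h : Bits n → Bits t) where

  HasEarlierTwin : Bits n → Set
  HasEarlierTwin x = ∃ λ y → toFin y <ᶠ toFin x × h y ≡ h x

  hasEarlierTwin? : ∀ x → Dec (HasEarlierTwin x)
  hasEarlierTwin? x = ∃Bits? (λ y → (toFin y <? toFin x) ×-dec (h y ≟ h x))

  tagged : Bits n → Bits (suc t)
  tagged x = does (hasEarlierTwin? x) ∷ h x

  earlier⇒≢ : ∀ {x y : Bits n} → toFin x <ᶠ toFin y → x ≢ y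
  earlier⇒≢ x<y refl = <-irrefl refl x<y

  equallyTagged⇒triple : ∀ {x y} → x ≢ y → h x ≡ h y →
                          (dx : Dec (HasEarlierTwin x)) (dy : Dec (HasEarlierTwin y)) →
                          does dx ≡ does dy → TripleCollision h
  equallyTagged⇒triple {x} {y} x≢y hx≡hy (yes (x′ , x′<x , hx′≡hx)) (yes (y′ , y′<y , hy′≡hy)) _
    with x′ ≟ y
  ... | no x′≢y = record
    { x₁ = x ; x₂ = y ; x₃ = x′
    ; distinct₁₂ = x≢y ; distinct₁₃ = earlier⇒≢ x′<x ∘ sym ; distinct₂₃ = x′≢y ∘ sym
    ; collide₁₂ = hx≡hy ; collide₁₃ = sym hx′≡hx }
  ... | yes refl = record
    { x₁ = x ; x₂ = y ; x₃ = y′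
    ; distinct₁₂ = x≢y ; distinct₁₃ = earlier⇒≢ (<-trans y′<y x′<x) ∘ sym
    ; distinct₂₃ = earlier⇒≢ y′<y ∘ sym
    ; collide₁₂ = hx≡hy ; collide₁₃ = trans hx≡hy (sym hy′≡hy) }
  equallyTagged⇒triple _ _ (yes _) (no _) ()
  equallyTagged⇒triple _ _ (no _) (yes _) ()
  equallyTagged⇒triple {x} {y} x≢y hx≡hy (no ¬twinˣ) (no ¬twinʸ) _ with <-cmp (toFin x) (toFin y)
  ... | tri< x<y _ _ = contradiction (x , x<y , hx≡hy) ¬twinʸ
  ... | tri≈ _ eq _  = contradiction (toFin-injective eq) x≢y
  ... | tri> _ _ y<x = contradiction (y , y<x , sym hx≡hy) ¬twinˣ

tripleCollision : ∀ {n t} → suc t < n → (h : Bits n → Bits t) → TripleCollision h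
tripleCollision 1+t<n h =
  equallyTagged⇒triple h distinct (cong tail collide)
    (hasEarlierTwin? h x₁) (hasEarlierTwin? h x₂) (cong head collide)
  where open Collision (collision 1+t<n (tagged h))

Agree : ∀ {n} → PartialFn n → Bits n → Bits n → Set
Agree f z z′ = ∀ {b b′} → f z ≡ just b → f z′ ≡ just b′ → b ≡ b′

≡⇒agree : ∀ {n} (f : PartialFn n) {z z′} → z ≡ z′ → Agree f z z′
≡⇒agree f refl fz fz′ = just-injective (trans (sym fz) fz′)

FactorsThrough : ∀ {n m} → PartialFn n → (Bits n → Bits m) → Set
FactorsThrough f Q = ∀ {z z′} → Q z ≡ Q z′ → Agree f z z′

defined? : (v : Maybe Bool) → Dec (∃ λ b → v ≡ just b)
defined? (just b) = yes (b , refl)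
defined? nothing  = no λ ()

module _ {n m} (f : PartialFn n) (Q : Bits n → Bits m) where

  definedInFibre? : ∀ v → Dec (∃ λ z → Q z ≡ v × ∃ λ b → f z ≡ just b)
  definedInFibre? v = ∃Bits? (λ z → (Q z ≟ v) ×-dec defined? (f z))

  fibreValue : Bits m → Bool
  fibreValue v with definedInFibre? v
  ... | yes (_ , _ , b , _) = b
  ... | no _                = false

  fibreValue-correct : FactorsThrough f Q → ∀ x b → f x ≡ just b → fibreValue (Q x) ≡ b
  fibreValue-correct agrees x b fx with definedInFibre? (Q x)
  ... | yes (z , Qz≡Qx , b′ , fz) = agrees Qz≡Qx fz fx
  ... | no none                   = contradiction (x , refl , b , fx) none

factorsThrough⇒nadt : ∀ {n m} (f : PartialFn n) (Q : Bits n → Bits m) →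
                      IsLinear Q → FactorsThrough f Q → NADTComputes f m
factorsThrough⇒nadt f Q Q-lin agrees with ss , ss-correct ← linear⇒parities Q Q-lin =
  ss , fibreValue f Q ,
  λ x b fx → trans (cong (fibreValue f Q) (ss-correct x)) (fibreValue-correct f Q agrees x b fx)

queryAll : ∀ {n} (f : PartialFn n) → NADTComputes f n
queryAll f = factorsThrough⇒nadt f id (λ _ _ → refl) (≡⇒agree f)

data Nonzero : ∀ {n} → Bits n → Set where
  here  : ∀ {n} {d : Bits n} → Nonzero (true ∷ d)
  there : ∀ {n} {d : Bits n} → Nonzero d → Nonzero (false ∷ d)

≢⇒nonzero-⊕ : ∀ {n} {x y : Bits n} → x ≢ y → Nonzero (x ⊕ y)
≢⇒nonzero-⊕ {x = []}      {[]}      x≢y = contradiction refl x≢y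
≢⇒nonzero-⊕ {x = true ∷ _}  {false ∷ _} _ = here
≢⇒nonzero-⊕ {x = false ∷ _} {true ∷ _}  _ = here
≢⇒nonzero-⊕ {x = true ∷ _}  {true ∷ _}  x≢y = there (≢⇒nonzero-⊕ (x≢y ∘ cong (true ∷_)))
≢⇒nonzero-⊕ {x = false ∷ _} {false ∷ _} x≢y = there (≢⇒nonzero-⊕ (x≢y ∘ cong (false ∷_)))

infix 21 _·_
_·_ : ∀ {n} → Bool → Bits n → Bits n
true  · d = d
false · d = 0s

·-distribʳ-xor : ∀ {n} a b (d : Bits n) → (a xor b) · d ≡ a · d ⊕ b · d
·-distribʳ-xor false false d = sym (⊕-self 0s)
·-distribʳ-xor false true  d = sym (⊕.identityˡ d)
·-distribʳ-xor true  false d = sym (⊕.identityʳ d)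
·-distribʳ-xor true  true  d = sym (⊕-self d)

-- With i the position of the leading 1 of d, u is sent to u ⊕ uᵢ · d with coordinate i deleted.
quotient : ∀ {m} (d : Bits (suc m)) → Nonzero d → Bits (suc m) → Bits m
quotient         (true ∷ d)   here       (b ∷ u) = u ⊕ b · d
quotient {suc m} (false ∷ d)  (there nz) (b ∷ u) = b ∷ quotient d nz u
quotient {zero}  (false ∷ []) (there ())

quotient-linear : ∀ {m} (d : Bits (suc m)) (nz : Nonzero d) → IsLinear (quotient d nz)
quotient-linear (true ∷ d) here (a ∷ u) (b ∷ v) =
  trans (cong ((u ⊕ v) ⊕_) (·-distribʳ-xor a b d)) (⊕.interchange u v (a · d) (b · d))
quotient-linear {suc m} (false ∷ d) (there nz) (a ∷ u) (b ∷ v) =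
  cong ((a xor b) ∷_) (quotient-linear d nz u v)
quotient-linear {zero} (false ∷ []) (there ())

quotient-kernel : ∀ {m} (d : Bits (suc m)) (nz : Nonzero d) u →
                  quotient d nz u ≡ 0s → u ≡ 0s ⊎ u ≡ d
quotient-kernel (true ∷ d) here (false ∷ u) eq = inj₁ (cong (false ∷_) (trans (sym (⊕.identityʳ u)) eq))
quotient-kernel (true ∷ d) here (true ∷ u)  eq = inj₂ (cong (true ∷_) (⊕≡0s⇒≡ eq))
quotient-kernel {suc m} (false ∷ d) (there nz) (false ∷ u) eq
  with quotient-kernel d nz u (cong tail eq)
... | inj₁ u≡0s = inj₁ (cong (false ∷_) u≡0s)
... | inj₂ u≡d  = inj₂ (cong (false ∷_) u≡d)
quotient-kernel {suc m} (false ∷ d) (there nz) (true ∷ u) ()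
quotient-kernel {zero} (false ∷ []) (there ())

quotient-fibre : ∀ {m} (d : Bits (suc m)) (nz : Nonzero d) {u v} →
                 quotient d nz u ≡ quotient d nz v → u ⊕ v ≡ 0s ⊎ u ⊕ v ≡ d
quotient-fibre d nz {u} {v} eq =
  quotient-kernel d nz (u ⊕ v) (linear-fibre (quotient d nz) (quotient-linear d nz) eq)

nadt⇒protocol : ∀ {n p} (f : PartialFn n) → NADTComputes f p → OneWayProtocol (XorLift f) p
nadt⇒protocol f (ss , l , correct) =
  parities ss , (λ m y → l (m ⊕ parities ss y)) ,
  λ x y b fxy → trans (cong l (sym (parities-linear ss x y))) (correct (x ⊕ y) b fxy)

collision⇒agree : ∀ {n t} {f : PartialFn n} (π : OneWayProtocol (XorLift f) t) {xa xb u v} →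
                  proj₁ π xa ≡ proj₁ π xb → u ⊕ v ≡ xa ⊕ xb → Agree f u v
collision⇒agree {f = f} (h , φ , correct) {xa} {xb} {u} {v} hxa≡hxb uv≡ {b} {b′} fu fv = begin
  b                ≡⟨ correct xa y b (trans (cong f xa⊕y≡u) fu) ⟨
  φ (h xa) y       ≡⟨ cong (λ m → φ m y) hxa≡hxb ⟩
  φ (h xb) y       ≡⟨ correct xb y b′ (trans (cong f (⊕.\\-leftDividesʳ xb v)) fv) ⟩
  b′               ∎
  where
  open ≡-Reasoning
  y = xb ⊕ v
  xa⊕y≡u : xa ⊕ y ≡ u
  xa⊕y≡u = trans (sym (⊕.assoc xa xb v)) (sym (⊕.x≈z//y u v (xa ⊕ xb) uv≡))

collision⇒nadt : ∀ {m t} (f : PartialFn (suc m)) (π : OneWayProtocol (XorLift f) t) →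
                 Collision (proj₁ π) → NADTComputes f m
collision⇒nadt f π c = factorsThrough⇒nadt f q (quotient-linear d nz) agrees
  where
  open Collision c
  d  = x₁ ⊕ x₂
  nz = ≢⇒nonzero-⊕ distinct
  q  = quotient d nz
  agrees : FactorsThrough f q
  agrees qz≡qz′ with quotient-fibre d nz qz≡qz′
  ... | inj₁ zz′≡0s = ≡⇒agree f (⊕≡0s⇒≡ zz′≡0s)
  ... | inj₂ zz′≡d  = collision⇒agree π collide zz′≡d

tripleCollision⇒nadt : ∀ {m t} (f : PartialFn (suc (suc m))) (π : OneWayProtocol (XorLift f) t) →
                       TripleCollision (proj₁ π) → NADTComputes f m
tripleCollision⇒nadt f π c =
  factorsThrough⇒nadt f (q′ ∘ q) (∘-linear q q′ q-linear (quotient-linear e nz′)) agrees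
  where
  open TripleCollision c
  d  = x₁ ⊕ x₂
  nz = ≢⇒nonzero-⊕ distinct₁₂
  q  = quotient d nz
  q-linear = quotient-linear d nz
  qx₁≢qx₃ : q x₁ ≢ q x₃
  qx₁≢qx₃ eq with quotient-fibre d nz eq
  ... | inj₁ x₁x₃≡0s = distinct₁₃ (⊕≡0s⇒≡ x₁x₃≡0s)
  ... | inj₂ x₁x₃≡d  = distinct₂₃ (sym (⊕.cancelˡ x₁ x₃ x₂ x₁x₃≡d))
  e   = q x₁ ⊕ q x₃
  nz′ = ≢⇒nonzero-⊕ qx₁≢qx₃
  q′  = quotient e nz′
  -- The kernel of q′ ∘ q is {0, x₁ ⊕ x₂, x₁ ⊕ x₃, x₂ ⊕ x₃}: each nonzero element is the
  -- difference of two inputs with the same message.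
  agrees : FactorsThrough f (q′ ∘ q)
  agrees {z} {z′} eq with quotient-fibre e nz′ eq
  ... | inj₁ qzqz′≡0s with quotient-fibre d nz (⊕≡0s⇒≡ qzqz′≡0s)
  ...   | inj₁ zz′≡0s = ≡⇒agree f (⊕≡0s⇒≡ zz′≡0s)
  ...   | inj₂ zz′≡d  = collision⇒agree π collide₁₂ zz′≡d
  agrees {z} {z′} eq | inj₂ qzqz′≡e
    with quotient-fibre d nz (trans (q-linear z z′) (trans qzqz′≡e (sym (q-linear x₁ x₃))))
  ... | inj₁ diff≡0s = collision⇒agree π collide₁₃ (⊕≡0s⇒≡ diff≡0s)
  ... | inj₂ diff≡d  = collision⇒agree π (trans (sym collide₁₂) collide₁₃)
                         (trans (⊕.x≈z//y _ _ _ diff≡d) (⊕-difference x₁ x₂ x₃))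

protocol-cost≥nadt : ∀ {n p t} (f : PartialFn n) → (∀ k → NADTComputes f k → p ≤ k) →
                     n ∸ 1 ≤ p → OneWayProtocol (XorLift f) t → p ≤ t
protocol-cost≥nadt {zero} f minimal _ _ = ≤-trans (minimal 0 (queryAll f)) z≤n
protocol-cost≥nadt {suc m} {t = t} f minimal _ π with ℕ.<-cmp t m
... | tri> _ _ m<t  = ≤-trans (minimal (suc m) (queryAll f)) m<t
... | tri≈ _ refl _ = minimal t (collision⇒nadt f π (collision ≤-refl (proj₁ π)))
protocol-cost≥nadt {suc zero}    f minimal _   π | tri< () _ _
protocol-cost≥nadt {suc (suc k)} f minimal k<p π | tri< (s≤s t≤k) _ _ =
  contradiction (≤-trans k<p (minimal k nadt)) (1+n≰n {k})
  where nadt = tripleCollision⇒nadt f π (tripleCollision (s≤s (s≤s t≤k)) (proj₁ π))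

theorem34 : ∀ (n : ℕ) (f : PartialFn n) (p : ℕ)
    → NADTIs f p
    → n ∸ 1 ≤ p
    → DccOneWayIs (XorLift f) p
theorem34 n f p (nadt , minimal) n∸1≤p =
  nadt⇒protocol f nadt , λ t → protocol-cost≥nadt f minimal n∸1≤p
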